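{- Let $\lambda$ be a partition, $\pi$ a reverse plane partition of shape $\lambda$, and $u,v\in\mathrm{cand}(\pi)$ distinct candidates such that $(Q(v,\pi),\pi)$ is compatible and $\pi-Q(v,\pi)$ is a reverse plane partition. Then $u\in\mathrm{cand}(\pi-Q(v,\pi))$.
   Context: Cells are pairs $(i,j)\in\mathbb Z^2$; $\mathrm n(i,j)=(i-1,j)$, $\mathrm e(i,j)=(i,j+1)$, $\mathrm s(i,j)=(i+1,j)$, $\mathrm w(i,j)=(i,j-1)$. A partition $\lambda$ is identified with its Young diagram. A reverse plane partition of shape $\lambda$ is $\pi:\lambda\to\mathbb N$ with $\pi(u)\le\pi(\mathrm e u),\pi(\mathrm s u)$, with conventions $\pi(i,j)=0$ if $i\le0$ or $j\le0$, $\pi(i,j)=\infty$ if $i,j\ge1$, $(i,j)\notin\lambda$. Content $c(i,j)=j-i$; outer corner: $u\in\lambda$, $\mathrm e u,\mathrm s u\notin\lambda$; inner corner: $\mathrm e u,\mathrm s u\in\lambda$, $\mathrm e\mathrm s u\notin\lambda$. With inner corner contents $i_1<\dots<i_r$ and outer corner contents $o_1<\dots<o_{r+1}$ (interlacing), $\mathcal I=\{u\in\lambda:c(u)=i_k\}$, $\mathcal O=\{u\in\lambda:c(u)=o_k\}$, $\mathcal A=\{u\in\lambda:c(u)<o_1\text{ or }i_k<c(u)<o_{k+1}\text{ for some }k\in[r]\}$, $\mathcal B=\{u\in\lambda:o_k<c(u)<i_k\text{ for some }k\in[r]\text{ or }c(u)>o_{r+1}\}$. Candidates: $\mathrm{cand}(\pi)=\{u\in\mathcal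 O:\pi(u)>\pi(\mathrm w u)\}\cup\{u\in\mathcal A:\pi(u)>\pi(\mathrm w u),\pi(u)>\pi(\mathrm n u)\}$. A north-east path is $(u_0,\dots,u_s)$ in $\lambda$ with $u_k\in\{\mathrm n u_{k-1},\mathrm e u_{k-1}\}$. $(\pi-P)(u)=\pi(u)-1$ for $u\in P$, else $\pi(u)$. $(P,\pi)$ compatible: $u\in P\cap(\mathcal I\cup\mathcal A)$ implies $\mathrm e u\in P$ and $\pi(u)=\pi(\mathrm e u)$; $u,\mathrm s u\in P$ implies $\pi(u)=\pi(\mathrm s u)$. For $v\in\mathrm{cand}(\pi)$, $Q(v,\pi)$ is the north-east path starting at $v$ which, from current cell $u$, moves to $\mathrm n u$ if $u\in\mathcal O\cup\mathcal B$ and $\pi(u)=\pi(\mathrm n u)$; to $\mathrm e u$ if $u\in\mathcal I\cup\mathcal A$, or if $\mathrm e u\in\lambda$ and $\pi(u)>\pi(\mathrm n u)$; and terminates if $\pi(u)>\pi(\mathrm n u)$ and $\mathrm e u\notin\lambda$. -}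

module Defs where

open import Data.Nat as ℕ using (ℕ; zero; suc)
open import Data.Integer as ℤ using (ℤ; +_; _-_; _+_)
import Data.Integer.Properties as ℤP
open import Data.Fin using (Fin; inject₁; fromℕ)
import Data.Fin as F
open import Data.Product using (Σ; ∃; _×_; _,_; proj₁; proj₂)
open import Data.Product.Properties using (≡-dec)
open import Data.Sum using (_⊎_)
open import Data.List using (List; []; _∷_)
open import Data.List.Relation.Unary.All using (All)
open import Data.List.Relation.Unary.Linked using (Linked)
open import Data.List.Membership.Propositional using (_∈_)
open import Data.List.Membership.DecPropositional (≡-dec ℤ._≟_ ℤ._≟_) using (_∈?_)
open import Relation.Nullary using (¬_; Dec; yes; no)
open import Relation.Nullary.Decidable using (_×-dec_)
open import Relation.Binary.PropositionalEquality using (_≡_)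
open import Function.Bundles using (_⇔_)

Cell : Set
Cell = ℤ × ℤ

nc ec sc wc : Cell → Cell
nc (i , j) = (i - + 1 , j)
ec (i , j) = (i , j + + 1)
sc (i , j) = (i + + 1 , j)
wc (i , j) = (i , j - + 1)

content : Cell → ℤ
content (i , j) = j - i

IsPartition : List ℕ → Set
IsPartition sh = All (ℕ._<_ 0) sh × Linked ℕ._≥_ sh

-- length of row i (rows indexed from 1); 0 for row 0 and rows beyond
rowLen : List ℕ → ℕ → ℕ
rowLen [] _ = 0
rowLen (x ∷ xs) zero = 0
rowLen (x ∷ xs) (suc zero) = x
rowLen (x ∷ xs) (suc (suc n)) = rowLen xs (suc n)

InShape : List ℕ → Cell → Set
InShape sh (i , j) = (+ 1 ℤ.≤ i) × (+ 1 ℤ.≤ j) × (j ℤ.≤ + rowLen sh ℤ.∣ i ∣)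

inShape? : (sh : List ℕ) → (u : Cell) → Dec (InShape sh u)
inShape? sh (i , j) = (+ 1 ℤ.≤? i) ×-dec ((+ 1 ℤ.≤? j) ×-dec (j ℤ.≤? + rowLen sh ℤ.∣ i ∣))

data ℤ∞ : Set where
  fin : ℤ → ℤ∞
  ∞   : ℤ∞

data _≤∞_ : ℤ∞ → ℤ∞ → Set where
  fin≤fin : ∀ {a b} → a ℤ.≤ b → fin a ≤∞ fin b
  x≤∞     : ∀ {x} → x ≤∞ ∞

data _<∞_ : ℤ∞ → ℤ∞ → Set where
  fin<fin : ∀ {a b} → a ℤ.< b → fin a <∞ fin b
  fin<∞   : ∀ {a} → fin a <∞ ∞

ext : List ℕ → (Cell → ℤ) → Cell → ℤ∞
ext sh π (i , j) with i ℤ.≤? + 0 | j ℤ.≤? + 0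
... | yes _ | _     = fin (+ 0)
... | no _  | yes _ = fin (+ 0)
... | no _  | no _  with inShape? sh (i , j)
...   | yes _ = fin (π (i , j))
...   | no _  = ∞

-- Reverse plane partitions (π is taken as a total function; only its
-- values on λ matter, values elsewhere are given by the conventions)

IsRPP : List ℕ → (Cell → ℤ) → Set
IsRPP sh π = ∀ u → InShape sh u →
  (+ 0 ℤ.≤ π u) × (ext sh π u ≤∞ ext sh π (ec u)) × (ext sh π u ≤∞ ext sh π (sc u))

OuterCorner : List ℕ → Cell → Set
OuterCorner sh u = InShape sh u × ¬ InShape sh (ec u) × ¬ InShape sh (sc u)

InnerCorner : List ℕ → Cell → Set
InnerCorner sh u = InShape sh (ec u) × InShape sh (sc u) × ¬ InShape sh (ec (sc u))

record CornerData (sh : List ℕ) : Set where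
  field
    r      : ℕ
    ic     : Fin r → ℤ
    oc     : Fin (suc r) → ℤ
    ic-inc : ∀ a b → a F.< b → ic a ℤ.< ic b
    oc-inc : ∀ a b → a F.< b → oc a ℤ.< oc b
    ic-spec : ∀ x → (∃ λ k → ic k ≡ x) ⇔ (∃ λ u → InnerCorner sh u × content u ≡ x)
    oc-spec : ∀ x → (∃ λ k → oc k ≡ x) ⇔ (∃ λ u → OuterCorner sh u × content u ≡ x)

module _ (sh : List ℕ) (cd : CornerData sh) where
  open CornerData cd

  𝓘 𝓞 𝓐 𝓑 : Cell → Set
  𝓘 u = InShape sh u × ∃ λ k → content u ≡ ic k
  𝓞 u = InShape sh u × ∃ λ k → content u ≡ oc k
  𝓐 u = InShape sh u ×
        ((content u ℤ.< oc F.zero) ⊎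
         (∃ λ (k : Fin r) → (ic k ℤ.< content u) × (content u ℤ.< oc (F.suc k))))
  𝓑 u = InShape sh u ×
        ((∃ λ (k : Fin r) → (oc (inject₁ k) ℤ.< content u) × (content u ℤ.< ic k)) ⊎
         (oc (fromℕ r) ℤ.< content u))

  Cand : (Cell → ℤ) → Cell → Set
  Cand π u =
    (𝓞 u × ext sh π (wc u) <∞ ext sh π u) ⊎
    (𝓐 u × ext sh π (wc u) <∞ ext sh π u × ext sh π (nc u) <∞ ext sh π u)

  Compatible : List Cell → (Cell → ℤ) → Set
  Compatible P π =
    (∀ u → u ∈ P → (𝓘 u ⊎ 𝓐 u) → (ec u ∈ P) × (π u ≡ π (ec u))) ×
    (∀ u → u ∈ P → sc u ∈ P → π u ≡ π (sc u))

  -- Q(v,π) ≡ P : the path produced by the process starting at v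
  data QPath (π : Cell → ℤ) : Cell → List Cell → Set where
    north : ∀ {u P} → (𝓞 u ⊎ 𝓑 u) → ext sh π u ≡ ext sh π (nc u) →
            QPath π (nc u) P → QPath π u (u ∷ P)
    east₁ : ∀ {u P} → (𝓘 u ⊎ 𝓐 u) →
            QPath π (ec u) P → QPath π u (u ∷ P)
    east₂ : ∀ {u P} → InShape sh (ec u) → ext sh π (nc u) <∞ ext sh π u →
            QPath π (ec u) P → QPath π u (u ∷ P)
    stop  : ∀ {u} → ext sh π (nc u) <∞ ext sh π u → ¬ InShape sh (ec u) →
            QPath π u (u ∷ [])

_minusPath_ : (Cell → ℤ) → List Cell → (Cell → ℤ)
(π minusPath P) u with u ∈? P
... | yes _ = π u - + 1
... | no _  = π u

-- The corner contents interlace, o₁ < i₁ < o₂ < … < i_r < o_{r+1}: a row i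
-- longer than row i + 1 ends in an outer corner of content λ_i - i and, if
-- row i + 1 is nonempty, contains an inner corner of content λ_{i+1} - i, and
-- both quantities decrease as i grows. So, with i₀ = -∞ and i_{r+1} = +∞, the
-- contents of 𝓞 ∪ 𝓐 form the runs (i_{k-1}, o_k] and those of 𝓞 ∪ 𝓑 the
-- runs [o_k, i_k).
-- If the candidate u lay on Q = Q(v,π), some cell p of Q would step into it.
-- A north step raises the content by one, which cannot lead from a run
-- [o_k, i_k) into a run (i_{k-1}, o_k]. An east step starts in 𝓘 ∪ 𝓐 (for the
-- second east rule because c(u) - 1 then lies in a run [i_{k-1}, o_k)), so
-- compatibility forces π(p) = π(u), contradicting π(w u) < π(u). Hence u ∉ Q,
-- and since π - Q ≤ π with equality at u, u remains a candidate.

module Submission where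

open import Defs
open import Data.Nat using (ℕ)
open import Data.Integer using (ℤ)
open import Data.List using (List)
open import Relation.Binary.PropositionalEquality using (_≢_)
open import Data.Nat as ℕ using (zero; suc; z≤n; s≤s; _≤′_; ≤′-reflexive; ≤′-step)
import Data.Nat.Properties as ℕP
open import Data.Integer as ℤ using (+_; -[1+_]; +≤+; +<+; _+_; _-_; -_; _≤_; _<_; _≤?_)
import Data.Integer.Properties as ℤP
open import Data.Integer.Tactic.RingSolver using (solve-∀)
open import Data.Fin as F using (Fin; inject₁; fromℕ)
import Data.Fin.Properties as FP
open import Data.Fin.Induction using (<-wellFounded)
open import Data.Fin.Relation.Unary.Top using (view; ‵fromℕ; ‵inject₁)
open import Data.Product using (∃; _×_; _,_; proj₁; proj₂)
open import Data.Product.Properties using (≡-dec)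
open import Data.Sum as Sum using (_⊎_; inj₁; inj₂; [_,_]′)
open import Data.Empty using (⊥-elim)
open import Data.List using ([]; _∷_; length)
open import Data.List.Relation.Unary.All using (All; _∷_)
open import Data.List.Relation.Unary.Linked using (Linked; _∷_)
open import Data.List.Relation.Unary.Any using (here; there)
open import Data.List.Membership.Propositional using (_∈_; _∉_)
open import Data.List.Membership.DecPropositional (≡-dec ℤ._≟_ ℤ._≟_) using (_∈?_)
open import Function.Base using (_∘_)
open import Function.Bundles using (Equivalence)
open import Induction.WellFounded using (Acc; acc)
open import Relation.Binary.Definitions using (tri<; tri≈; tri>)
open import Relation.Binary.PropositionalEquality using (_≡_; refl; sym; trans; cong; subst; subst₂)
open import Relation.Nullary using (¬_; yes; no)

i<j⇒i+1≤j : ∀ {i j} → i < j → i + + 1 ≤ j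
i<j⇒i+1≤j {i} i<j = subst (_≤ _) (ℤP.+-comm (+ 1) i) (ℤP.i<j⇒suc[i]≤j i<j)

i+1≤j⇒i<j : ∀ {i j} → i + + 1 ≤ j → i < j
i+1≤j⇒i<j {i} i+1≤j = ℤP.suc[i]≤j⇒i<j (subst (_≤ _) (ℤP.+-comm i (+ 1)) i+1≤j)

i<j+1⇒i≤j : ∀ {i j} → i < j + + 1 → i ≤ j
i<j+1⇒i≤j i<j+1 = ℤP.≮⇒≥ (λ j<i → ℤP.<⇒≱ i<j+1 (i<j⇒i+1≤j j<i))

i≤i+1 : ∀ i → i ≤ i + + 1
i≤i+1 i = ℤP.i≤i+j i (+ 1)

+1≰+0 : ¬ (+ 1 ≤ + 0)
+1≰+0 (+≤+ ())

minus-mono-≤ : ∀ {a b c d} → a ≤ b → d ≤ c → a - c ≤ b - d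
minus-mono-≤ a≤b d≤c = ℤP.+-mono-≤ a≤b (ℤP.neg-mono-≤ d≤c)

minus-mono-≤-< : ∀ {a b c d} → a ≤ b → d < c → a - c < b - d
minus-mono-≤-< a≤b d<c = ℤP.+-mono-≤-< a≤b (ℤP.neg-mono-< d<c)

content-nc : ∀ i j → content (nc (i , j)) ≡ content (i , j) + + 1
content-nc i j = shift i j
  where
  shift : ∀ i j → j - (i - + 1) ≡ (j - i) + + 1
  shift = solve-∀

content-ec : ∀ i j → content (ec (i , j)) ≡ content (i , j) + + 1
content-ec i j = shift i j
  where
  shift : ∀ i j → (j + + 1) - i ≡ (j - i) + + 1
  shift = solve-∀

wc-ec : ∀ u → wc (ec u) ≡ u
wc-ec (i , j) = cong (i ,_) (cancel j)
  where
  cancel : ∀ j → (j + + 1) - + 1 ≡ j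
  cancel = solve-∀

inject₁<suc : ∀ {n} (k : Fin n) → inject₁ k F.< F.suc k
inject₁<suc _ = FP.≤̄⇒inject₁< FP.≤-refl

<⇒suc≤inject₁ : ∀ {n} {m k : Fin n} → m F.< k → F.suc m F.≤ inject₁ k
<⇒suc≤inject₁ {k = k} m<k = subst (ℕ._≤_ _) (sym (FP.toℕ-inject₁ k)) m<k

<suc⇒≤inject₁ : ∀ {n} {j : Fin (suc n)} {k : Fin n} → j F.< F.suc k → j F.≤ inject₁ k
<suc⇒≤inject₁ {k = k} (s≤s j≤k) = subst (ℕ._≤_ _) (sym (FP.toℕ-inject₁ k)) j≤k

StrictlyIncreasing : ∀ {n} → (Fin n → ℤ) → Set
StrictlyIncreasing f = ∀ a b → a F.< b → f a < f b

module _ {n} {f : Fin n → ℤ} (f-inc : StrictlyIncreasing f) where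

  increasing⇒monotone : ∀ {a b} → a F.≤ b → f a ≤ f b
  increasing⇒monotone {a} {b} a≤b with a F.≟ b
  ... | yes refl = ℤP.≤-refl
  ... | no a≢b = ℤP.<⇒≤ (f-inc a b (FP.≤∧≢⇒< a≤b a≢b))

  increasing⇒cancel-< : ∀ {a b} → f a < f b → a F.< b
  increasing⇒cancel-< {a} {b} fa<fb with FP.<-cmp a b
  ... | tri< a<b _ _ = a<b
  ... | tri≈ _ refl _ = ⊥-elim (ℤP.<-irrefl refl fa<fb)
  ... | tri> _ _ b<a = ⊥-elim (ℤP.<-asym fa<fb (f-inc b a b<a))

record Interlaced {r} (ic : Fin r → ℤ) (oc : Fin (suc r) → ℤ) : Set where
  field
    outer<inner : ∀ k → oc (inject₁ k) < ic k
    inner<outer : ∀ k → ic k < oc (F.suc k)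

module _ {r} {ic : Fin r → ℤ} {oc : Fin (suc r) → ℤ}
         (ic-inc : StrictlyIncreasing ic) (oc-inc : StrictlyIncreasing oc)
         (disjoint : ∀ k j → ic k ≢ oc j)
         (inner-between : ∀ a b → oc a < oc b → ∃ λ m → oc a < ic m × ic m < oc b)
         (outer-between : ∀ a b → ic a < ic b → ∃ λ j → ic a < oc j × oc j < ic b)
         (outer-below : ∀ k → ∃ λ j → oc j < ic k)
         where

  -- Both inequalities go by well-founded induction on k: through the
  -- betweenness hypotheses, a violation at k yields one at a smaller index.
  private
    inner<outer-acc : ∀ k → Acc F._<_ k → ic k < oc (F.suc k)
    inner<outer-acc k (acc rec) = ℤP.≤∧≢⇒< (ℤP.≮⇒≥ not-above) (disjoint k (F.suc k))
      where
      not-above : ¬ oc (F.suc k) < ic k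
      not-above o<iₖ =
        let (m , oₖ<iₘ , iₘ<o) = inner-between (inject₁ k) (F.suc k) (oc-inc _ _ (inject₁<suc k))
            m<k = increasing⇒cancel-< ic-inc (ℤP.<-trans iₘ<o o<iₖ)
        in ℤP.<-asym oₖ<iₘ (ℤP.<-≤-trans (inner<outer-acc m (rec m<k))
                                           (increasing⇒monotone oc-inc (<⇒suc≤inject₁ m<k)))

    outer<inner-acc : ∀ k → Acc F._<_ k → oc (inject₁ k) < ic k
    inner≮outer-acc : ∀ k → Acc F._<_ k → ¬ ic k < oc (inject₁ k)

    outer<inner-acc k rec =
      ℤP.≤∧≢⇒< (ℤP.≮⇒≥ (inner≮outer-acc k rec)) (disjoint k (inject₁ k) ∘ sym)

    inner≮outer-acc F.zero _ i₀<o₀ =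
      let (j , oⱼ<i₀) = outer-below F.zero
      in ℤP.<-asym i₀<o₀ (ℤP.≤-<-trans (increasing⇒monotone oc-inc z≤n) oⱼ<i₀)
    inner≮outer-acc (F.suc k) (acc rec) i<o =
      let (j , iₖ<oⱼ , oⱼ<i) = outer-between (inject₁ k) (F.suc k) (ic-inc _ _ (inject₁<suc k))
          j≤k = <suc⇒≤inject₁ (increasing⇒cancel-< oc-inc (ℤP.<-trans oⱼ<i i<o))
      in ℤP.<-asym iₖ<oⱼ (ℤP.≤-<-trans (increasing⇒monotone oc-inc j≤k)
                                         (outer<inner-acc (inject₁ k) (rec (inject₁<suc k))))

  interlaced : Interlaced ic oc
  interlaced = record
    { outer<inner = λ k → outer<inner-acc k (<-wellFounded k)
    ; inner<outer = λ k → inner<outer-acc k (<-wellFounded k)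
    }

module Runs {r} {ic : Fin r → ℤ} {oc : Fin (suc r) → ℤ}
            (ic-inc : StrictlyIncreasing ic) (oc-inc : StrictlyIncreasing oc)
            (il : Interlaced ic oc) where
  open Interlaced il

  -- 𝓞, 𝓘, 𝓐 and 𝓑 consist of the cells of the shape whose content satisfies
  -- OuterContent, InnerContent, Ascending and Descending respectively.
  OuterContent InnerContent Ascending Descending AscendingRun DescendingRun : ℤ → Set
  OuterContent x = ∃ λ k → x ≡ oc k
  InnerContent x = ∃ λ k → x ≡ ic k
  Ascending x = (x < oc F.zero) ⊎ (∃ λ (k : Fin r) → (ic k < x) × (x < oc (F.suc k)))
  Descending x = (∃ λ (k : Fin r) → (oc (inject₁ k) < x) × (x < ic k)) ⊎ (oc (fromℕ r) < x)
  AscendingRun x = (x ≤ oc F.zero) ⊎ (∃ λ (k : Fin r) → (ic k < x) × (x ≤ oc (F.suc k)))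
  DescendingRun x = (∃ λ (k : Fin r) → (oc (inject₁ k) ≤ x) × (x < ic k)) ⊎ (oc (fromℕ r) ≤ x)

  outer⊎ascending⇒ascendingRun : ∀ {x} → OuterContent x ⊎ Ascending x → AscendingRun x
  outer⊎ascending⇒ascendingRun (inj₁ (F.zero , refl)) = inj₁ ℤP.≤-refl
  outer⊎ascending⇒ascendingRun (inj₁ (F.suc k , refl)) = inj₂ (k , inner<outer k , ℤP.≤-refl)
  outer⊎ascending⇒ascendingRun (inj₂ (inj₁ x<o)) = inj₁ (ℤP.<⇒≤ x<o)
  outer⊎ascending⇒ascendingRun (inj₂ (inj₂ (k , i<x , x<o))) = inj₂ (k , i<x , ℤP.<⇒≤ x<o)

  outer⊎descending⇒descendingRun : ∀ {x} → OuterContent x ⊎ Descending x → DescendingRun x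
  outer⊎descending⇒descendingRun (inj₁ (j , refl)) with view j
  ... | ‵fromℕ = inj₂ ℤP.≤-refl
  ... | ‵inject₁ k = inj₁ (k , ℤP.≤-refl , outer<inner k)
  outer⊎descending⇒descendingRun (inj₂ (inj₁ (k , o<x , x<i))) = inj₁ (k , ℤP.<⇒≤ o<x , x<i)
  outer⊎descending⇒descendingRun (inj₂ (inj₂ o<x)) = inj₂ (ℤP.<⇒≤ o<x)

  private
    outer-gap : ∀ {a b x} → b F.≤ a → oc a ≤ x → ¬ x + + 1 ≤ oc b
    outer-gap b≤a oₐ≤x x+1≤o_b =
      ℤP.<-irrefl refl
        (i+1≤j⇒i<j (ℤP.≤-trans x+1≤o_b (ℤP.≤-trans (increasing⇒monotone oc-inc b≤a) oₐ≤x)))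

  descendingRun⇒¬ascendingRun-suc : ∀ {x} → DescendingRun x → ¬ AscendingRun (x + + 1)
  descendingRun⇒¬ascendingRun-suc (inj₁ (_ , o≤x , _)) (inj₁ x+1≤o) = outer-gap z≤n o≤x x+1≤o
  descendingRun⇒¬ascendingRun-suc (inj₁ (k , o≤x , x<i)) (inj₂ (k′ , i′<x+1 , x+1≤o)) =
    outer-gap (<⇒suc≤inject₁ k′<k) o≤x x+1≤o
    where
    k′<k = increasing⇒cancel-< ic-inc (ℤP.<-≤-trans i′<x+1 (i<j⇒i+1≤j x<i))
  descendingRun⇒¬ascendingRun-suc (inj₂ o≤x) (inj₁ x+1≤o) = outer-gap z≤n o≤x x+1≤o
  descendingRun⇒¬ascendingRun-suc (inj₂ o≤x) (inj₂ (_ , _ , x+1≤o)) = outer-gap (FP.≤fromℕ _) o≤x x+1≤o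

  ascendingRun-suc⇒inner⊎ascending : ∀ {x} → AscendingRun (x + + 1) → InnerContent x ⊎ Ascending x
  ascendingRun-suc⇒inner⊎ascending (inj₁ x+1≤o) = inj₂ (inj₁ (i+1≤j⇒i<j x+1≤o))
  ascendingRun-suc⇒inner⊎ascending {x} (inj₂ (k , i<x+1 , x+1≤o)) with ic k ℤ.≟ x
  ... | yes i≡x = inj₁ (k , sym i≡x)
  ... | no i≢x = inj₂ (inj₂ (k , ℤP.≤∧≢⇒< (i<j+1⇒i≤j i<x+1) i≢x , i+1≤j⇒i<j x+1≤o))

rowLen-step : ∀ {sh} → Linked ℕ._≥_ sh → ∀ n → rowLen sh (suc (suc n)) ℕ.≤ rowLen sh (suc n)
rowLen-step {[]} _ _ = z≤n
rowLen-step {_ ∷ []} _ _ = z≤n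
rowLen-step {_ ∷ _ ∷ _} (x≥y ∷ _) zero = x≥y
rowLen-step {_ ∷ _ ∷ _} (_ ∷ linked) (suc n) = rowLen-step linked n

rowLen-antitone : ∀ {sh m n} → Linked ℕ._≥_ sh → m ≤′ n → rowLen sh (suc n) ℕ.≤ rowLen sh (suc m)
rowLen-antitone _ (≤′-reflexive refl) = ℕP.≤-refl
rowLen-antitone linked (≤′-step m≤′n) = ℕP.≤-trans (rowLen-step linked _) (rowLen-antitone linked m≤′n)

rowLen-beyond : ∀ sh {n} → length sh ℕ.< n → rowLen sh n ≡ 0
rowLen-beyond [] _ = refl
rowLen-beyond (_ ∷ _) {zero} ()
rowLen-beyond (_ ∷ _) {suc zero} (s≤s ())
rowLen-beyond (_ ∷ xs) {suc (suc n)} (s≤s beyond) = rowLen-beyond xs beyond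

rowLen-pos⇒≤length : ∀ {sh n} → 0 ℕ.< rowLen sh n → n ℕ.≤ length sh
rowLen-pos⇒≤length {sh} pos = ℕP.≮⇒≥ (λ beyond → ℕP.<-irrefl (sym (rowLen-beyond sh beyond)) pos)

rowLen-length : ∀ {sh n} → All (0 ℕ.<_) sh → 0 ℕ.< rowLen sh n → 0 ℕ.< rowLen sh (length sh)
rowLen-length {[]} _ ()
rowLen-length {_ ∷ []} (x>0 ∷ _) _ = x>0
rowLen-length {_ ∷ _ ∷ _} (_ ∷ positive@(y>0 ∷ _)) _ = rowLen-length {n = 1} positive y>0

module _ {sh : List ℕ} (isP : IsPartition sh) where

  row : ℤ → ℤ
  row i = + rowLen sh ℤ.∣ i ∣

  row-antitone : ∀ {a b} → + 1 ≤ a → a ≤ b → row b ≤ row a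
  row-antitone {+ zero} (+≤+ ()) _
  row-antitone { -[1+ _ ]} () _
  row-antitone {+ suc _} {+ zero} _ (+≤+ ())
  row-antitone {+ suc _} { -[1+ _ ]} _ ()
  row-antitone {+ suc _} {+ suc _} _ (+≤+ (s≤s a≤b)) =
    +≤+ (rowLen-antitone (proj₂ isP) (ℕP.≤⇒≤′ a≤b))

  Descent : ℤ → Set
  Descent i = (+ 1 ≤ i) × (row (i + + 1) < row i)

  outerContent innerContent : ℤ → ℤ
  outerContent i = row i - i
  innerContent i = row (i + + 1) - i

  descent-nonempty : ∀ {i} → Descent i → + 1 ≤ row i
  descent-nonempty (_ , longer) = i<j⇒i+1≤j (ℤP.≤-<-trans (+≤+ z≤n) longer)

  outerCorner⇒descent : ∀ {i j} → OuterCorner sh (i , j) → Descent i × j ≡ row i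
  outerCorner⇒descent {i} {j} ((1≤i , 1≤j , j≤row) , ¬east , ¬south) =
    (1≤i , subst (row (i + + 1) <_) j≡row row′<j) , j≡row
    where
    row′<j = ℤP.≰⇒> λ j≤row′ → ¬south (ℤP.≤-trans 1≤i (i≤i+1 i) , 1≤j , j≤row′)
    j≡row : j ≡ row i
    j≡row = ℤP.≤-antisym j≤row
      (i<j+1⇒i≤j (ℤP.≰⇒> λ j+1≤row → ¬east (1≤i , ℤP.≤-trans 1≤j (i≤i+1 j) , j+1≤row)))

  descent⇒outerCorner : ∀ {i} → Descent i → OuterCorner sh (i , row i)
  descent⇒outerCorner d@(1≤i , longer) =
    (1≤i , descent-nonempty d , ℤP.≤-refl) ,
    (λ (_ , _ , row+1≤row) → ℤP.<-irrefl refl (i+1≤j⇒i<j row+1≤row)) ,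
    (λ (_ , _ , row≤row′) → ℤP.<⇒≱ longer row≤row′)

  innerCorner⇒descent : ∀ {i j} → InnerCorner sh (i , j) →
                        Descent i × (+ 1 ≤ j) × (j ≡ row (i + + 1))
  innerCorner⇒descent {i} {j} ((1≤i , _ , j+1≤row) , (1≤i+1 , 1≤j , j≤row′) , ¬southeast) =
    (1≤i , subst (_< row i) j≡row′ (i+1≤j⇒i<j j+1≤row)) , 1≤j , j≡row′
    where
    j≡row′ : j ≡ row (i + + 1)
    j≡row′ = ℤP.≤-antisym j≤row′
      (i<j+1⇒i≤j (ℤP.≰⇒> λ j+1≤row′ →
        ¬southeast (1≤i+1 , ℤP.≤-trans 1≤j (i≤i+1 j) , j+1≤row′)))

  descent⇒innerCorner : ∀ {i} → Descent i → + 1 ≤ row (i + + 1) → InnerCorner sh (i , row (i + + 1))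
  descent⇒innerCorner {i} (1≤i , longer) nonempty =
    (1≤i , ℤP.≤-trans nonempty (i≤i+1 _) , i<j⇒i+1≤j longer) ,
    (ℤP.≤-trans 1≤i (i≤i+1 i) , nonempty , ℤP.≤-refl) ,
    (λ (_ , _ , row′+1≤row′) → ℤP.<-irrefl refl (i+1≤j⇒i<j row′+1≤row′))

  outerContent-antitone : ∀ {a b} → + 1 ≤ a → a ≤ b → outerContent b ≤ outerContent a
  outerContent-antitone 1≤a a≤b = minus-mono-≤ (row-antitone 1≤a a≤b) a≤b

  innerContent-antitone : ∀ {a b} → + 1 ≤ a → a ≤ b → innerContent b ≤ innerContent a
  innerContent-antitone {a} 1≤a a≤b =
    minus-mono-≤ (row-antitone (ℤP.≤-trans 1≤a (i≤i+1 a)) (ℤP.+-monoˡ-≤ (+ 1) a≤b)) a≤b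

  innerContent<outerContent : ∀ {i} → Descent i → innerContent i < outerContent i
  innerContent<outerContent {i} (_ , longer) = ℤP.+-monoˡ-< (- i) longer

  outerContent<innerContent : ∀ {a b} → + 1 ≤ a → a < b → outerContent b < innerContent a
  outerContent<innerContent {a} 1≤a a<b =
    minus-mono-≤-< (row-antitone (ℤP.≤-trans 1≤a (i≤i+1 a)) (i<j⇒i+1≤j a<b)) a<b

  outerContent-<⇒> : ∀ {a b} → + 1 ≤ a → outerContent a < outerContent b → b < a
  outerContent-<⇒> 1≤a oa<ob = ℤP.≰⇒> λ a≤b → ℤP.<⇒≱ oa<ob (outerContent-antitone 1≤a a≤b)

  innerContent-<⇒> : ∀ {a b} → + 1 ≤ a → innerContent a < innerContent b → b < a
  innerContent-<⇒> 1≤a ia<ib = ℤP.≰⇒> λ a≤b → ℤP.<⇒≱ ia<ib (innerContent-antitone 1≤a a≤b)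

  outerContent≢innerContent : ∀ {a b} → Descent a → Descent b → outerContent a ≢ innerContent b
  outerContent≢innerContent {a} {b} da db oa≡ib with a ≤? b
  ... | yes a≤b = ℤP.<-irrefl (sym oa≡ib)
                    (ℤP.≤-<-trans (innerContent-antitone (proj₁ da) a≤b) (innerContent<outerContent da))
  ... | no a≰b = ℤP.<-irrefl oa≡ib (outerContent<innerContent (proj₁ db) (ℤP.≰⇒> a≰b))

  innerCorner-between : ∀ {a b} → Descent a → Descent b → outerContent a < outerContent b →
    (+ 1 ≤ row (b + + 1)) × (outerContent a < innerContent b) × (innerContent b < outerContent b)
  innerCorner-between {a} {b} da db oa<ob =
    ℤP.≤-trans (descent-nonempty da) (row-antitone (ℤP.≤-trans (proj₁ db) (i≤i+1 b)) (i<j⇒i+1≤j b<a)) ,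
    outerContent<innerContent (proj₁ db) b<a ,
    innerContent<outerContent db
    where
    b<a = outerContent-<⇒> (proj₁ da) oa<ob

  outerCorner-between : ∀ {a b} → Descent a → Descent b → innerContent a < innerContent b →
    (innerContent a < outerContent a) × (outerContent a < innerContent b)
  outerCorner-between da db ia<ib =
    innerContent<outerContent da , outerContent<innerContent (proj₁ db) (innerContent-<⇒> (proj₁ da) ia<ib)

  -- The witness is the last row of the partition.
  outerCorner-below : ∀ {i} → Descent i → + 1 ≤ row (i + + 1) →
    ∃ λ ℓ → Descent ℓ × outerContent ℓ < innerContent i
  outerCorner-below {+ zero} (+≤+ () , _) _
  outerCorner-below { -[1+ _ ]} (() , _) _
  outerCorner-below {+ suc a} (1≤i , _) (+≤+ nonempty) =
    + ℓ , (ℤP.≤-trans 1≤i (ℤP.<⇒≤ i<ℓ) , last-longer) , outerContent<innerContent 1≤i i<ℓ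
    where
    ℓ = length sh
    i<ℓ : + suc a < + ℓ
    i<ℓ = i+1≤j⇒i<j (+≤+ (rowLen-pos⇒≤length {sh} nonempty))
    last-longer : row (+ ℓ + + 1) < row (+ ℓ)
    last-longer = subst (λ n → + n < row (+ ℓ)) (sym (rowLen-beyond sh (ℕP.m<m+n ℓ (s≤s z≤n))))
                        (+<+ (rowLen-length (proj₁ isP) nonempty))

  module _ (cd : CornerData sh) where
    open CornerData cd

    oc⇒descent : ∀ k → ∃ λ i → Descent i × oc k ≡ outerContent i
    oc⇒descent k with Equivalence.to (oc-spec (oc k)) (k , refl)
    ... | (i , _) , corner , content≡ with outerCorner⇒descent corner
    ...   | d , refl = i , d , sym content≡

    ic⇒descent : ∀ k → ∃ λ i → Descent i × (+ 1 ≤ row (i + + 1)) × ic k ≡ innerContent i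
    ic⇒descent k with Equivalence.to (ic-spec (ic k)) (k , refl)
    ... | (i , _) , corner , content≡ with innerCorner⇒descent corner
    ...   | d , nonempty , refl = i , d , nonempty , sym content≡

    descent⇒oc : ∀ {i} → Descent i → ∃ λ k → oc k ≡ outerContent i
    descent⇒oc {i} d = Equivalence.from (oc-spec _) ((i , row i) , descent⇒outerCorner d , refl)

    descent⇒ic : ∀ {i} → Descent i → + 1 ≤ row (i + + 1) → ∃ λ k → ic k ≡ innerContent i
    descent⇒ic {i} d nonempty =
      Equivalence.from (ic-spec _) ((i , row (i + + 1)) , descent⇒innerCorner d nonempty , refl)

    cornerInterlaced : Interlaced ic oc
    cornerInterlaced = interlaced ic-inc oc-inc disjoint inner-between outer-between outer-below
      where
      disjoint : ∀ k j → ic k ≢ oc j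
      disjoint k j iₖ≡oⱼ =
        let (_ , db , _ , iₖ≡) = ic⇒descent k
            (_ , da , oⱼ≡) = oc⇒descent j
        in outerContent≢innerContent da db (trans (sym oⱼ≡) (trans (sym iₖ≡oⱼ) iₖ≡))

      inner-between : ∀ a b → oc a < oc b → ∃ λ m → oc a < ic m × ic m < oc b
      inner-between a b oₐ<o_b =
        let (_ , da , oₐ≡) = oc⇒descent a
            (_ , db , o_b≡) = oc⇒descent b
            (nonempty , oₐ<i , i<o_b) = innerCorner-between da db (subst₂ _<_ oₐ≡ o_b≡ oₐ<o_b)
            (m , iₘ≡) = descent⇒ic db nonempty
        in m , subst₂ _<_ (sym oₐ≡) (sym iₘ≡) oₐ<i , subst₂ _<_ (sym iₘ≡) (sym o_b≡) i<o_b

      outer-between : ∀ a b → ic a < ic b → ∃ λ j → ic a < oc j × oc j < ic b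
      outer-between a b iₐ<i_b =
        let (_ , da , _ , iₐ≡) = ic⇒descent a
            (_ , db , _ , i_b≡) = ic⇒descent b
            (iₐ<o , o<i_b) = outerCorner-between da db (subst₂ _<_ iₐ≡ i_b≡ iₐ<i_b)
            (j , oⱼ≡) = descent⇒oc da
        in j , subst₂ _<_ (sym iₐ≡) (sym oⱼ≡) iₐ<o , subst₂ _<_ (sym oⱼ≡) (sym i_b≡) o<i_b

      outer-below : ∀ k → ∃ λ j → oc j < ic k
      outer-below k =
        let (_ , d , nonempty , iₖ≡) = ic⇒descent k
            (_ , dℓ , o<i) = outerCorner-below d nonempty
            (j , oⱼ≡) = descent⇒oc dℓ
        in j , subst₂ _<_ (sym oⱼ≡) (sym iₖ≡) o<i

<∞-irrefl : ∀ {x} → ¬ x <∞ x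
<∞-irrefl (fin<fin x<x) = ℤP.<-irrefl refl x<x

≤∞-<∞-trans : ∀ {x y z} → x ≤∞ y → y <∞ z → x <∞ z
≤∞-<∞-trans (fin≤fin x≤y) (fin<fin y<z) = fin<fin (ℤP.≤-<-trans x≤y y<z)
≤∞-<∞-trans (fin≤fin _) fin<∞ = fin<∞

ext-inShape : ∀ {sh π u} → InShape sh u → ext sh π u ≡ fin (π u)
ext-inShape {sh} {u = i , j} inside@(1≤i , 1≤j , _) with i ℤ.≤? + 0 | j ℤ.≤? + 0
... | yes i≤0 | _ = ⊥-elim (+1≰+0 (ℤP.≤-trans 1≤i i≤0))
... | no _ | yes j≤0 = ⊥-elim (+1≰+0 (ℤP.≤-trans 1≤j j≤0))
... | no _ | no _ with inShape? sh (i , j)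
...   | yes _ = refl
...   | no outside = ⊥-elim (outside inside)

ext-column≤0 : ∀ {sh π i j} → j ≤ + 0 → ext sh π (i , j) ≡ fin (+ 0)
ext-column≤0 {i = i} {j} j≤0 with i ℤ.≤? + 0 | j ℤ.≤? + 0
... | yes _ | _ = refl
... | no _ | yes _ = refl
... | no _ | no j≰0 = ⊥-elim (j≰0 j≤0)

ext-cong : ∀ {sh π π′} u → π u ≡ π′ u → ext sh π u ≡ ext sh π′ u
ext-cong {sh} (i , j) πu≡π′u with i ℤ.≤? + 0 | j ℤ.≤? + 0
... | yes _ | _ = refl
... | no _ | yes _ = refl
... | no _ | no _ with inShape? sh (i , j)
...   | yes _ = cong fin πu≡π′u
...   | no _ = refl

ext-mono : ∀ {sh π π′} → (∀ w → π′ w ≤ π w) → ∀ u → ext sh π′ u ≤∞ ext sh π u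
ext-mono {sh} π′≤π (i , j) with i ℤ.≤? + 0 | j ℤ.≤? + 0
... | yes _ | _ = fin≤fin ℤP.≤-refl
... | no _ | yes _ = fin≤fin ℤP.≤-refl
... | no _ | no _ with inShape? sh (i , j)
...   | yes _ = fin≤fin (π′≤π (i , j))
...   | no _ = x≤∞

ext-<∞-lower : ∀ {sh π π′ u} w → (∀ w → π′ w ≤ π w) → π′ u ≡ π u →
               ext sh π w <∞ ext sh π u → ext sh π′ w <∞ ext sh π′ u
ext-<∞-lower {sh} {π} {π′} {u} w π′≤π π′u≡πu w<u =
  subst (ext sh π′ w <∞_) (ext-cong u (sym π′u≡πu)) (≤∞-<∞-trans (ext-mono π′≤π w) w<u)

cand-lower : ∀ {sh} (cd : CornerData sh) {π π′ u} → (∀ w → π′ w ≤ π w) → π′ u ≡ π u →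
             Cand sh cd π u → Cand sh cd π′ u
cand-lower _ {u = u} π′≤π π′u≡πu (inj₁ (o , w<u)) =
  inj₁ (o , ext-<∞-lower (wc u) π′≤π π′u≡πu w<u)
cand-lower _ {u = u} π′≤π π′u≡πu (inj₂ (a , w<u , n<u)) =
  inj₂ (a , ext-<∞-lower (wc u) π′≤π π′u≡πu w<u , ext-<∞-lower (nc u) π′≤π π′u≡πu n<u)

minusPath-≤ : ∀ π P w → (π minusPath P) w ≤ π w
minusPath-≤ π P w with w ∈? P
... | yes _ = ℤP.i-j≤i (π w) (+ 1)
... | no _ = ℤP.≤-refl

minusPath-∉ : ∀ π P {w} → w ∉ P → (π minusPath P) w ≡ π w
minusPath-∉ π P {w} w∉P with w ∈? P
... | yes w∈P = ⊥-elim (w∉P w∈P)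
... | no _ = refl

module _ {sh : List ℕ} (cd : CornerData sh) (π : Cell → ℤ) where

  data Step : Cell → Cell → Set where
    north : ∀ {p} → 𝓞 sh cd p ⊎ 𝓑 sh cd p → Step p (nc p)
    east₁ : ∀ {p} → 𝓘 sh cd p ⊎ 𝓐 sh cd p → Step p (ec p)
    east₂ : ∀ {p} → InShape sh (ec p) → ext sh π (nc p) <∞ ext sh π p → Step p (ec p)

  QPath-∈ : ∀ {v Q w} → QPath sh cd π v Q → w ∈ Q → w ≡ v ⊎ ∃ λ p → p ∈ Q × Step p w
  step-∈ : ∀ {v v′ Q w} → Step v v′ → QPath sh cd π v′ Q → w ∈ v ∷ Q →
           w ≡ v ⊎ ∃ λ p → p ∈ v ∷ Q × Step p w

  QPath-∈ (north ob _ q) = step-∈ (north ob) q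
  QPath-∈ (east₁ ia q) = step-∈ (east₁ ia) q
  QPath-∈ (east₂ inside n<p q) = step-∈ (east₂ inside n<p) q
  QPath-∈ (stop _ _) (here refl) = inj₁ refl

  step-∈ _ _ (here refl) = inj₁ refl
  step-∈ step q (there w∈Q) with QPath-∈ q w∈Q
  ... | inj₁ refl = inj₂ (_ , here refl , step)
  ... | inj₂ (p , p∈Q , step′) = inj₂ (p , there p∈Q , step′)

module _ {sh : List ℕ} (cd : CornerData sh) (il : Interlaced (CornerData.ic cd) (CornerData.oc cd)) where
  open CornerData cd
  open Runs ic-inc oc-inc il

  cand-content : ∀ {π u} → Cand sh cd π u →
                 InShape sh u × (OuterContent (content u) ⊎ Ascending (content u))
  cand-content (inj₁ ((inside , o) , _)) = inside , inj₁ o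
  cand-content (inj₂ ((inside , a) , _)) = inside , inj₂ a

  cand-west : ∀ {π u} → Cand sh cd π u → ext sh π (wc u) <∞ ext sh π u
  cand-west (inj₁ (_ , w<u)) = w<u
  cand-west (inj₂ (_ , w<u , _)) = w<u

  ¬north-into-cand : ∀ {π p} → 𝓞 sh cd p ⊎ 𝓑 sh cd p → ¬ Cand sh cd π (nc p)
  ¬north-into-cand {p = i , j} ob cu =
    descendingRun⇒¬ascendingRun-suc (outer⊎descending⇒descendingRun (Sum.map proj₂ proj₂ ob))
      (subst AscendingRun (content-nc i j) (outer⊎ascending⇒ascendingRun (proj₂ (cand-content cu))))

  ¬compatible-east-into-cand : ∀ {π p Q} → Compatible sh cd Q π → p ∈ Q →
                               𝓘 sh cd p ⊎ 𝓐 sh cd p → ¬ Cand sh cd π (ec p)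
  ¬compatible-east-into-cand {π} {p} (east-closed , _) p∈Q ia cu =
    <∞-irrefl (subst (λ x → fin (π p) <∞ fin x) (sym πp≡πep) p<ep)
    where
    πp≡πep = proj₂ (east-closed p p∈Q ia)
    p<ep : fin (π p) <∞ fin (π (ec p))
    p<ep = subst₂ _<∞_ (trans (cong (ext sh π) (wc-ec p)) (ext-inShape ([ proj₁ , proj₁ ]′ ia)))
                      (ext-inShape (proj₁ (cand-content cu))) (cand-west cu)

  east₂-source : ∀ {π p} → InShape sh (ec p) → ext sh π (nc p) <∞ ext sh π p →
                 OuterContent (content (ec p)) ⊎ Ascending (content (ec p)) → 𝓘 sh cd p ⊎ 𝓐 sh cd p
  east₂-source {π} {p = i , j} (1≤i , _ , j+1≤row) n<p oa with + 1 ≤? j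
  ... | no 1≰j =
    ⊥-elim (<∞-irrefl (subst₂ _<∞_ (ext-column≤0 {sh} {π} {i - + 1} j≤0) (ext-column≤0 {sh} {π} {i} j≤0) n<p))
    where
    j≤0 = i<j+1⇒i≤j (ℤP.≰⇒> 1≰j)
  ... | yes 1≤j = Sum.map (inside ,_) (inside ,_)
                    (ascendingRun-suc⇒inner⊎ascending
                      (subst AscendingRun (content-ec i j) (outer⊎ascending⇒ascendingRun oa)))
    where
    inside = 1≤i , 1≤j , ℤP.≤-trans (i≤i+1 j) j+1≤row

  cand∉QPath : ∀ {π u v Q} → Cand sh cd π u → u ≢ v → QPath sh cd π v Q →
               Compatible sh cd Q π → u ∉ Q
  cand∉QPath {π} cu u≢v q compatible u∈Q with QPath-∈ cd π q u∈Q
  ... | inj₁ u≡v = u≢v u≡v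
  ... | inj₂ (_ , _ , north ob) = ¬north-into-cand ob cu
  ... | inj₂ (_ , p∈Q , east₁ ia) = ¬compatible-east-into-cand compatible p∈Q ia cu
  ... | inj₂ (_ , p∈Q , east₂ inside n<p) =
    ¬compatible-east-into-cand compatible p∈Q (east₂-source inside n<p (proj₂ (cand-content cu))) cu

mainTheorem10 : (sh : List ℕ) → IsPartition sh → (cd : CornerData sh) →
    (π : Cell → ℤ) → IsRPP sh π →
    (u v : Cell) → Cand sh cd π u → Cand sh cd π v → u ≢ v →
    (Q : List Cell) → QPath sh cd π v Q →
    Compatible sh cd Q π → IsRPP sh (π minusPath Q) →
    Cand sh cd (π minusPath Q) u
mainTheorem10 sh isP cd π _ u v cu _ u≢v Q q compatible _ =
  cand-lower cd (minusPath-≤ π Q) (minusPath-∉ π Q u∉Q) cu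
  where
  u∉Q : u ∉ Q
  u∉Q = cand∉QPath cd (cornerInterlaced isP cd) cu u≢v q compatible
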